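{- Let $\mathcal{C}_1$ and $\mathcal{C}_2$ be CCCs and let $\mathcal{R}$ be the CCC of logical relations from $\mathcal{C}_1$ to $\mathcal{C}_2$. Suppose $\mathcal{R}$ is equipped with a squeezing structure such that: for every object $c$ of $\mathcal{R}$, the relation of $L_c$ is surjective and the relation of $R_c$ is functional; for every left morphism $(u_1,u_2)$ the function $\mathcal{C}_2(1,u_2) = u_2\circ(-)$ is surjective; and for every right morphism $(v_1,v_2)$ the function $\mathcal{C}_2(1,v_2) = v_2\circ(-)$ is injective. Then for every object $(c_1,c_2,\Vdash)$ of $\mathrm{Sqz}(\mathcal{R})$, the relation $\Vdash$ is a partial surjection.
   Context: The CCC of logical relations $\mathcal{R}$ from $\mathcal{C}_1$ to $\mathcal{C}_2$ has objects triples $(c_1,c_2,\Vdash)$ with $c_i$ an object of $\mathcal{C}_i$ and $\Vdash \subseteq \mathcal{C}_1(1,c_1)\times\mathcal{C}_2(1,c_2)$; morphisms $(c_1,c_2,\Vdash)\to(c_1',c_2',\Vdash')$ are pairs $(f_1,f_2)\in\mathcal{C}_1(c_1,c_1')\times\mathcal{C}_2(c_2,c_2')$ such that $x_1\Vdash x_2$ implies $f_1\circ x_1 \Vdash' f_2\circ x_2$. It is a CCC (terminal object $(1,1,\text{full relation})$, products componentwise with $\langle x_1,y_1\rangle$ related to $\langle x_2,y_2\rangle$ iff $x_1\Vdash x_2$ and $y_1\Vdash' y_2$, exponentials componentwise with $g_1$ related to $g_2$ iff $x_1\Vdash x_2$ implies $\mathrm{ev}\circ\langle g_1,x_1\rangle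 \Vdash' \mathrm{ev}\circ\langle g_2,x_2\rangle$). A relation $\Vdash \subseteq X_1\times X_2$ is functional if $x_1\Vdash x_2$ and $x_1\Vdash x_2'$ imply $x_2=x_2'$, surjective if every $x_2\in X_2$ has some $x_1$ with $x_1\Vdash x_2$, and a partial surjection if both. A squeezing structure on a CCC $\mathcal{D}$ consists of two wide subcategories $\mathcal{D}_{\mathrm{left}}$, $\mathcal{D}_{\mathrm{right}}$ (left/right morphisms), each stable under finite cartesian products, such that for left $u:c_l\to c_l'$ and right $v:c_r\to c_r'$, $v\Rightarrow u:(c_r'\Rightarrow c_l)\to(c_r\Rightarrow c_l')$ is left and $u\Rightarrow v:(c_l'\Rightarrow c_r)\to(c_l\Rightarrow c_r')$ is right; together with objects $L_c,R_c$ for each object $c$ such that there exist left morphisms $1\to L_1$, $L_c\times L_{c'}\to L_{c\times c'}$, $(R_c\Rightarrow L_{c'})\to L_{c\Rightarrow c'}$ and right morphisms $1\to R_1$, $R_c\times R_{c'}\to R_{c\times c'}$, $(L_c\Rightarrow R_{c'})\to R_{c\Rightarrow c'}$. $\mathrm{Sqz}(\mathcal{D})$ is the full subcategory of objects $c$ admitting a left morphism $L_c\to c$ and a right morphism $c\to R_c$. -}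

module Defs where

open import Level using (Level; _⊔_; suc)
open import Data.Product using (Σ; ∃; _×_; _,_; proj₁; proj₂)
open import Data.Unit.Polymorphic using (⊤; tt)
open import Relation.Binary.PropositionalEquality
  using (_≡_; refl; sym; trans; cong; cong₂; subst; subst₂)

record CCC (o ℓ : Level) : Set (suc (o ⊔ ℓ)) where
  infixr 9 _∘_
  infixr 5 _⇒_
  infixr 7 _×ₒ_
  field
    Obj   : Set o
    Hom   : Obj → Obj → Set ℓ
    id    : ∀ {A} → Hom A A
    _∘_   : ∀ {A B C} → Hom B C → Hom A B → Hom A C
    idˡ   : ∀ {A B} (f : Hom A B) → id ∘ f ≡ f
    idʳ   : ∀ {A B} (f : Hom A B) → f ∘ id ≡ f
    assoc : ∀ {A B C D} (h : Hom C D) (g : Hom B C) (f : Hom A B) →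
            (h ∘ g) ∘ f ≡ h ∘ (g ∘ f)
    𝟙        : Obj
    !        : ∀ {A} → Hom A 𝟙
    !-unique : ∀ {A} (f : Hom A 𝟙) → f ≡ !
    _×ₒ_      : Obj → Obj → Obj
    π₁        : ∀ {A B} → Hom (A ×ₒ B) A
    π₂        : ∀ {A B} → Hom (A ×ₒ B) B
    ⟨_,_⟩     : ∀ {C A B} → Hom C A → Hom C B → Hom C (A ×ₒ B)
    π₁-β      : ∀ {C A B} (f : Hom C A) (g : Hom C B) → π₁ ∘ ⟨ f , g ⟩ ≡ f
    π₂-β      : ∀ {C A B} (f : Hom C A) (g : Hom C B) → π₂ ∘ ⟨ f , g ⟩ ≡ g
    ⟨⟩-unique : ∀ {C A B} (f : Hom C A) (g : Hom C B) (h : Hom C (A ×ₒ B)) →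
                π₁ ∘ h ≡ f → π₂ ∘ h ≡ g → h ≡ ⟨ f , g ⟩
    _⇒_          : Obj → Obj → Obj
    ev           : ∀ {A B} → Hom ((A ⇒ B) ×ₒ A) B
    curry        : ∀ {C A B} → Hom (C ×ₒ A) B → Hom C (A ⇒ B)
    ev-β         : ∀ {C A B} (f : Hom (C ×ₒ A) B) →
                   ev ∘ ⟨ curry f ∘ π₁ , π₂ ⟩ ≡ f
    curry-unique : ∀ {C A B} (f : Hom (C ×ₒ A) B) (g : Hom C (A ⇒ B)) →
                   ev ∘ ⟨ g ∘ π₁ , π₂ ⟩ ≡ f → g ≡ curry f

  El : Obj → Set ℓ
  El A = Hom 𝟙 A

  _⊗_ : ∀ {A A' B B'} → Hom A A' → Hom B B' → Hom (A ×ₒ B) (A' ×ₒ B')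
  f ⊗ g = ⟨ f ∘ π₁ , g ∘ π₂ ⟩

  _⇛_ : ∀ {A A' B B'} → Hom A A' → Hom B B' → Hom (A' ⇒ B) (A ⇒ B')
  f ⇛ g = curry (g ∘ (ev ∘ ⟨ π₁ , f ∘ π₂ ⟩))

  ⟨⟩-∘ : ∀ {D C A B} (f : Hom C A) (g : Hom C B) (h : Hom D C) →
         ⟨ f , g ⟩ ∘ h ≡ ⟨ f ∘ h , g ∘ h ⟩
  ⟨⟩-∘ f g h = ⟨⟩-unique (f ∘ h) (g ∘ h) (⟨ f , g ⟩ ∘ h)
    (trans (sym (assoc π₁ ⟨ f , g ⟩ h)) (cong (_∘ h) (π₁-β f g)))
    (trans (sym (assoc π₂ ⟨ f , g ⟩ h)) (cong (_∘ h) (π₂-β f g)))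

  π₁-⊗ : ∀ {X A A' B B'} (f : Hom A A') (g : Hom B B') (z : Hom X (A ×ₒ B)) →
         π₁ ∘ ((f ⊗ g) ∘ z) ≡ f ∘ (π₁ ∘ z)
  π₁-⊗ f g z = trans (sym (assoc π₁ (f ⊗ g) z))
               (trans (cong (_∘ z) (π₁-β (f ∘ π₁) (g ∘ π₂))) (assoc f π₁ z))

  π₂-⊗ : ∀ {X A A' B B'} (f : Hom A A') (g : Hom B B') (z : Hom X (A ×ₒ B)) →
         π₂ ∘ ((f ⊗ g) ∘ z) ≡ g ∘ (π₂ ∘ z)
  π₂-⊗ f g z = trans (sym (assoc π₂ (f ⊗ g) z))
               (trans (cong (_∘ z) (π₂-β (f ∘ π₁) (g ∘ π₂))) (assoc g π₂ z))

  ev-curry : ∀ {X C A B} (h : Hom (C ×ₒ A) B) (k : Hom X C) (x : Hom X A) →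
             ev ∘ ⟨ curry h ∘ k , x ⟩ ≡ h ∘ ⟨ k , x ⟩
  ev-curry h k x =
    trans (cong (ev ∘_) eq)
    (trans (sym (assoc ev ⟨ curry h ∘ π₁ , π₂ ⟩ ⟨ k , x ⟩))
           (cong (_∘ ⟨ k , x ⟩) (ev-β h)))
    where
    eq : ⟨ curry h ∘ k , x ⟩ ≡ ⟨ curry h ∘ π₁ , π₂ ⟩ ∘ ⟨ k , x ⟩
    eq = sym (trans (⟨⟩-∘ (curry h ∘ π₁) π₂ ⟨ k , x ⟩)
              (cong₂ ⟨_,_⟩
                (trans (assoc (curry h) π₁ ⟨ k , x ⟩) (cong (curry h ∘_) (π₁-β k x)))
                (π₂-β k x)))

  ev-⇛ : ∀ {X A A' B B'} (f : Hom A A') (g : Hom B B')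
         (k : Hom X (A' ⇒ B)) (x : Hom X A) →
         ev ∘ ⟨ (f ⇛ g) ∘ k , x ⟩ ≡ g ∘ (ev ∘ ⟨ k , f ∘ x ⟩)
  ev-⇛ f g k x =
    trans (ev-curry (g ∘ (ev ∘ ⟨ π₁ , f ∘ π₂ ⟩)) k x)
    (trans (assoc g (ev ∘ ⟨ π₁ , f ∘ π₂ ⟩) ⟨ k , x ⟩)
    (cong (g ∘_) (trans (assoc ev ⟨ π₁ , f ∘ π₂ ⟩ ⟨ k , x ⟩)
      (cong (ev ∘_) (trans (⟨⟩-∘ π₁ (f ∘ π₂) ⟨ k , x ⟩)
        (cong₂ ⟨_,_⟩ (π₁-β k x)
          (trans (assoc f π₂ ⟨ k , x ⟩) (cong (f ∘_) (π₂-β k x)))))))))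

module _ {a b r : Level} {X₁ : Set a} {X₂ : Set b} where

  FunctionalRel : (X₁ → X₂ → Set r) → Set (a ⊔ b ⊔ r)
  FunctionalRel _⊩_ = ∀ {x₁ x₂ x₂'} → x₁ ⊩ x₂ → x₁ ⊩ x₂' → x₂ ≡ x₂'

  SurjectiveRel : (X₁ → X₂ → Set r) → Set (a ⊔ b ⊔ r)
  SurjectiveRel _⊩_ = ∀ x₂ → Σ X₁ (λ x₁ → x₁ ⊩ x₂)

  PartialSurjection : (X₁ → X₂ → Set r) → Set (a ⊔ b ⊔ r)
  PartialSurjection R = FunctionalRel R × SurjectiveRel R

module _ {a b : Level} {X : Set a} {Y : Set b} where

  SurjectiveFn : (X → Y) → Set (a ⊔ b)
  SurjectiveFn f = ∀ y → Σ X (λ x → f x ≡ y)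

  InjectiveFn : (X → Y) → Set (a ⊔ b)
  InjectiveFn f = ∀ {x x'} → f x ≡ f x' → x ≡ x'

module LogRel {o₁ ℓ₁ o₂ ℓ₂ : Level} (C₁ : CCC o₁ ℓ₁) (C₂ : CCC o₂ ℓ₂)
              (r : Level) where

  private
    module C₁ = CCC C₁
    module C₂ = CCC C₂

  -- relations live in Set ρ; ρ must be at least ℓ₁ ⊔ ℓ₂ so that the
  -- exponential relation (quantifying over global elements) fits
  ρ : Level
  ρ = ℓ₁ ⊔ ℓ₂ ⊔ r

  record Obj : Set (o₁ ⊔ o₂ ⊔ ℓ₁ ⊔ ℓ₂ ⊔ suc ρ) where
    constructor obj
    field
      ob₁ : C₁.Obj
      ob₂ : C₂.Obj
      rel : C₁.El ob₁ → C₂.El ob₂ → Set ρ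
  open Obj public

  record Hom (A B : Obj) : Set ρ where
    constructor hom
    field
      f₁   : C₁.Hom (ob₁ A) (ob₁ B)
      f₂   : C₂.Hom (ob₂ A) (ob₂ B)
      pres : ∀ {x₁ x₂} → rel A x₁ x₂ → rel B (f₁ C₁.∘ x₁) (f₂ C₂.∘ x₂)
  open Hom public

  id : ∀ {A} → Hom A A
  id {A} = hom C₁.id C₂.id
    (λ {x₁} {x₂} p → subst₂ (rel A) (sym (C₁.idˡ x₁)) (sym (C₂.idˡ x₂)) p)

  _∘_ : ∀ {A B C} → Hom B C → Hom A B → Hom A C
  _∘_ {A} {B} {C} g f = hom (f₁ g C₁.∘ f₁ f) (f₂ g C₂.∘ f₂ f)
    (λ {x₁} {x₂} p → subst₂ (rel C)
       (sym (C₁.assoc (f₁ g) (f₁ f) x₁)) (sym (C₂.assoc (f₂ g) (f₂ f) x₂))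
       (pres g (pres f p)))

  𝟙 : Obj
  𝟙 = obj C₁.𝟙 C₂.𝟙 (λ _ _ → ⊤)

  _×ₒ_ : Obj → Obj → Obj
  A ×ₒ B = obj (ob₁ A C₁.×ₒ ob₁ B) (ob₂ A C₂.×ₒ ob₂ B)
    (λ z₁ z₂ → rel A (C₁.π₁ C₁.∘ z₁) (C₂.π₁ C₂.∘ z₂)
             × rel B (C₁.π₂ C₁.∘ z₁) (C₂.π₂ C₂.∘ z₂))

  _⇒_ : Obj → Obj → Obj
  A ⇒ B = obj (ob₁ A C₁.⇒ ob₁ B) (ob₂ A C₂.⇒ ob₂ B)
    (λ g₁ g₂ → ∀ {x₁ x₂} → rel A x₁ x₂ →
       rel B (C₁.ev C₁.∘ C₁.⟨ g₁ , x₁ ⟩) (C₂.ev C₂.∘ C₂.⟨ g₂ , x₂ ⟩))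

  _⊗_ : ∀ {A A' B B'} → Hom A A' → Hom B B' → Hom (A ×ₒ B) (A' ×ₒ B')
  _⊗_ {A} {A'} {B} {B'} f g = hom (f₁ f C₁.⊗ f₁ g) (f₂ f C₂.⊗ f₂ g)
    (λ {z₁} {z₂} (p , q) →
      subst₂ (rel A') (sym (C₁.π₁-⊗ (f₁ f) (f₁ g) z₁)) (sym (C₂.π₁-⊗ (f₂ f) (f₂ g) z₂))
        (pres f p)
      , subst₂ (rel B') (sym (C₁.π₂-⊗ (f₁ f) (f₁ g) z₁)) (sym (C₂.π₂-⊗ (f₂ f) (f₂ g) z₂))
        (pres g q))

  _⇛_ : ∀ {A A' B B'} → Hom A A' → Hom B B' → Hom (A' ⇒ B) (A ⇒ B')
  _⇛_ {A} {A'} {B} {B'} f g = hom (f₁ f C₁.⇛ f₁ g) (f₂ f C₂.⇛ f₂ g)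
    (λ {k₁} {k₂} p {x₁} {x₂} q →
      subst₂ (rel B')
        (sym (C₁.ev-⇛ (f₁ f) (f₁ g) k₁ x₁)) (sym (C₂.ev-⇛ (f₂ f) (f₂ g) k₂ x₂))
        (pres g (p (pres f q))))

  -- a wide subcategory (given by a predicate on morphisms) stable under
  -- finite cartesian products (the nullary case is id on 𝟙)
  record WideProdStable {p : Level} (P : ∀ {A B} → Hom A B → Set p)
         : Set (o₁ ⊔ o₂ ⊔ ℓ₁ ⊔ ℓ₂ ⊔ suc ρ ⊔ p) where
    field
      id-closed : ∀ {A} → P (id {A})
      ∘-closed  : ∀ {A B C} {g : Hom B C} {f : Hom A B} → P g → P f → P (g ∘ f)
      ⊗-closed  : ∀ {A A' B B'} {f : Hom A A'} {g : Hom B B'} →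
                  P f → P g → P (f ⊗ g)

  record Squeezing (p : Level) : Set (o₁ ⊔ o₂ ⊔ ℓ₁ ⊔ ℓ₂ ⊔ suc ρ ⊔ suc p) where
    field
      Left  : ∀ {A B} → Hom A B → Set p
      Right : ∀ {A B} → Hom A B → Set p
      left-sub  : WideProdStable Left
      right-sub : WideProdStable Right
      ⇛-left  : ∀ {cₗ cₗ' cᵣ cᵣ'} {u : Hom cₗ cₗ'} {v : Hom cᵣ cᵣ'} →
                Left u → Right v → Left (v ⇛ u)
      ⇛-right : ∀ {cₗ cₗ' cᵣ cᵣ'} {u : Hom cₗ cₗ'} {v : Hom cᵣ cᵣ'} →
                Left u → Right v → Right (u ⇛ v)
      L : Obj → Obj
      R : Obj → Obj
      L-𝟙 : Σ (Hom 𝟙 (L 𝟙)) Left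
      L-× : ∀ c c' → Σ (Hom (L c ×ₒ L c') (L (c ×ₒ c'))) Left
      L-⇒ : ∀ c c' → Σ (Hom (R c ⇒ L c') (L (c ⇒ c'))) Left
      R-𝟙 : Σ (Hom 𝟙 (R 𝟙)) Right
      R-× : ∀ c c' → Σ (Hom (R c ×ₒ R c') (R (c ×ₒ c'))) Right
      R-⇒ : ∀ c c' → Σ (Hom (L c ⇒ R c') (R (c ⇒ c'))) Right

  InSqz : ∀ {p} → Squeezing p → Obj → Set (ρ ⊔ p)
  InSqz S c = Σ (Hom (Squeezing.L S c) c) (Squeezing.Left S)
            × Σ (Hom c (Squeezing.R S c)) (Squeezing.Right S)

module Submission where

open import Defs
open import Level using (Level)
open import Data.Product using (_,_)
open import Relation.Binary.PropositionalEquality using (subst)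

-- Sqz(R) squeezes c between a left morphism L c → c and a right morphism c → R c.
-- Functionality of R c is reflected along the right morphism because its second
-- component is injective on global elements, and surjectivity of L c is carried
-- forward along the left morphism because its second component is surjective on
-- global elements.

module _ {o₁ ℓ₁ o₂ ℓ₂ : Level} {C₁ : CCC o₁ ℓ₁} {C₂ : CCC o₂ ℓ₂} {r : Level} where

  open LogRel C₁ C₂ r
  private module C₂ = CCC C₂

  functional-reflected : ∀ {A B} (v : Hom A B) →
    InjectiveFn (λ (x : C₂.El (ob₂ A)) → f₂ v C₂.∘ x) →
    FunctionalRel (rel B) → FunctionalRel (rel A)
  functional-reflected v injective functionalB p q =
    injective (functionalB (pres v p) (pres v q))

  surjective-transported : ∀ {A B} (u : Hom A B) →
    SurjectiveFn (λ (x : C₂.El (ob₂ A)) → f₂ u C₂.∘ x) →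
    SurjectiveRel (rel A) → SurjectiveRel (rel B)
  surjective-transported {B = B} u surjective surjectiveA y₂
    with surjective y₂
  ... | x₂ , u₂x₂≡y₂ with surjectiveA x₂
  ... | x₁ , x₁⊩x₂ = _ , subst (rel B _) u₂x₂≡y₂ (pres u x₁⊩x₂)

lemma4p11 : ∀ {o₁ ℓ₁ o₂ ℓ₂ r p : Level} (C₁ : CCC o₁ ℓ₁) (C₂ : CCC o₂ ℓ₂)
    (S : LogRel.Squeezing C₁ C₂ r p) →
    (∀ c → SurjectiveRel (LogRel.Obj.rel (LogRel.Squeezing.L S c))) →
    (∀ c → FunctionalRel (LogRel.Obj.rel (LogRel.Squeezing.R S c))) →
    (∀ {A B} (u : LogRel.Hom C₁ C₂ r A B) → LogRel.Squeezing.Left S u →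
      SurjectiveFn (λ (x : CCC.El C₂ (LogRel.Obj.ob₂ A)) →
        CCC._∘_ C₂ (LogRel.Hom.f₂ u) x)) →
    (∀ {A B} (v : LogRel.Hom C₁ C₂ r A B) → LogRel.Squeezing.Right S v →
      InjectiveFn (λ (x : CCC.El C₂ (LogRel.Obj.ob₂ A)) →
        CCC._∘_ C₂ (LogRel.Hom.f₂ v) x)) →
    ∀ (c : LogRel.Obj C₁ C₂ r) → LogRel.InSqz C₁ C₂ r S c →
    PartialSurjection (LogRel.Obj.rel c)
lemma4p11 C₁ C₂ S L-surjective R-functional left-surjective right-injective
          c ((u , u-left) , (v , v-right)) =
    functional-reflected v (right-injective v v-right) (R-functional c)
  , surjective-transported u (left-surjective u u-left) (L-surjective c)
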